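{- Let $P_n$ be the path with vertices $1,\ldots,n$ and let $A$ be a set of vertices with $2\leq |A|=m\leq n$. The following are equivalent: (1) $A$ is a maximizer of $W$ on $P_n$. (2) $A$ is a local maximizer of $W$ on $P_n$. (3) If $m$ is even, then $A=\{1,\ldots,\tfrac{m}{2}\}\cup\{n-\tfrac{m}{2}+1,\ldots,n\}$; and if $m$ is odd, then $A=\{1,\ldots,\tfrac{m-1}{2}\}\cup\{j\}\cup\{n-\tfrac{m-1}{2}+1,\ldots,n\}$ for some integer $j$ with $\tfrac{m-1}{2}<j<n-\tfrac{m-1}{2}+1$.
   Context: $P_n$ has edges $\{u,u+1\}$; $d(u,v)=|u-v|$. $W(X)=\sum_{\{u,v\}\subseteq X,\,u\neq v}d(u,v)$ (unordered pairs). $A$ is a maximizer of $W$ if $W(A)=\max\{W(B): B\subseteq V(P_n), |B|=|A|\}$. A perturbation of $A$ is a set $(A\setminus\{u\})\cup\{v\}$ with $u\in A$, $v\notin A$, $\{u,v\}$ an edge; $A$ is a local maximizer of $W$ if $W(A)=\max\{W(B): B\text{ a perturbation of }A\}$. -}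

module Defs where

open import Data.Nat using (ℕ; zero; suc; _+_; _∸_; _≤_; _<_; _≤ᵇ_; ∣_-_∣)
open import Data.Bool using (Bool; true; false; _∧_; if_then_else_)
open import Data.Fin using (Fin; toℕ)
open import Data.Fin.Subset using (Subset; _∈_; _∉_; _∪_; _-_; ⁅_⁆)
open import Data.Vec using (lookup; tabulate)
open import Data.List using (map; allFin)
open import Data.Nat.ListAction using (sum)
open import Data.Product using (∃₂; _×_)
open import Data.Sum using (_⊎_)
open import Relation.Binary.PropositionalEquality using (_≡_)

-- Vertices of P_n are 1,…,n; the element i : Fin n stands for vertex (toℕ i + 1).
vertex : ∀ {n} → Fin n → ℕ
vertex i = suc (toℕ i)

dist : ∀ {n} → Fin n → Fin n → ℕ
dist u v = ∣ vertex u - vertex v ∣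

Edge : ∀ {n} → Fin n → Fin n → Set
Edge u v = (vertex v ≡ suc (vertex u)) ⊎ (vertex u ≡ suc (vertex v))

-- W(X) = sum over unordered pairs {u,v} ⊆ X, u ≠ v, of d(u,v)
-- (each unordered pair is counted once, as the ordered pair with vertex u < vertex v)
W : ∀ {n} → Subset n → ℕ
W {n} X = sum (map (λ u → sum (map (λ v →
            if lookup X u ∧ lookup X v ∧ (suc (vertex u) ≤ᵇ vertex v)
            then dist u v else 0) (allFin n))) (allFin n))

Maximizer : ∀ {n} → Subset n → Set
Maximizer {n} A = (B : Subset n) → Data.Fin.Subset.∣ B ∣ ≡ Data.Fin.Subset.∣ A ∣ → W B ≤ W A

Perturbation : ∀ {n} → Subset n → Subset n → Set
Perturbation A B = ∃₂ λ u v → u ∈ A × v ∉ A × Edge u v × B ≡ (A - u) ∪ ⁅ v ⁆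

LocalMaximizer : ∀ {n} → Subset n → Set
LocalMaximizer {n} A = (B : Subset n) → Perturbation A B → W B ≤ W A

interval : (n a b : ℕ) → Subset n
interval n a b = tabulate (λ i → (a ≤ᵇ vertex i) ∧ (vertex i ≤ᵇ b))

{-# OPTIONS --safe #-}
-- Moving one member of A a single step to the right, onto a free vertex, changes W by l − r, where
-- l and r count the other members of A on its left and on its right. Hence A is a local maximizer
-- exactly when every member with a free right neighbour has l ≤ r and every member with a free left
-- neighbour has r ≤ l. Scanning from the left, this packs the lower ⌊m/2⌋ members onto 1, 2, … and
-- the upper ⌊m/2⌋ onto …, n − 1, n, and leaves only the median free when m is odd. Moving the median
-- has l = r, so all sets of this shape have the same W. A maximizer exists and is a local maximizer,
-- so it has this shape, and hence every set of this shape attains the maximum.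
module Submission where

open import Defs
open import Data.Bool using (true; false; _∧_; _∨_; if_then_else_)
open import Data.Bool.Properties using (∧-zeroʳ; ∧-identityʳ; ∨-identityʳ; ¬-not)
open import Data.Empty using (⊥-elim)
open import Data.Fin using (Fin) renaming (zero to fzero; suc to fsuc)
open import Data.Fin.Subset using (Subset; ∣_∣; _─_; _-_; _∪_; ⁅_⁆; ⊥; ⊤; _∉_)
open import Data.Fin.Subset.Properties using (∣⊤∣≡n; ∣p∣≤n; ∪-identityˡ; ∪-identityʳ; p─⊥≡p)
open import Data.List using (map; allFin; tabulate)
open import Data.List.Properties using (map-tabulate; map-cong)
open import Data.Nat using (ℕ; zero; suc; pred; _+_; _*_; _∸_; _/_; _%_; _≡ᵇ_; _≤ᵇ_; _<ᵇ_; _≤_; _<_; z≤n; s≤s; s≤s⁻¹)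
open import Data.Nat.DivMod using (m≡m%n+[m/n]*n; m*n/n≡m; m%n<n)
open import Data.Nat.ListAction using (sum)
open import Data.Nat.Properties
open import Algebra.Properties.CommutativeSemigroup +-commutativeSemigroup using (x∙yz≈y∙xz)
open import Data.Nat.Tactic.RingSolver using (solve-∀)
import Data.Product as Product
open import Data.Product using (∃-syntax; ∃; ∃₂; _,_; _×_)
import Data.Sum as Sum
open import Data.Sum using (_⊎_; inj₁; inj₂)
open import Data.Vec using ([]; _∷_; lookup; here; there)
open import Data.Vec.Properties using ([]=⇒lookup; lookup⇒[]=)
open import Function using (_∘_; id)
open import Function.Bundles using (_⇔_; mk⇔)
open import Relation.Binary.PropositionalEquality
open import Relation.Nullary using (yes; no; contradiction)

∑ : (n : ℕ) → (Fin n → ℕ) → ℕ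
∑ zero    f = 0
∑ (suc n) f = f fzero + ∑ n (f ∘ fsuc)

sum-allFin : ∀ n (f : Fin n → ℕ) → sum (map f (allFin n)) ≡ ∑ n f
sum-allFin zero    f = refl
sum-allFin (suc n) f = cong (f fzero +_) (begin
  sum (map f (tabulate fsuc))              ≡⟨ cong sum (map-tabulate fsuc f) ⟩
  sum (tabulate (f ∘ fsuc))                ≡⟨ cong sum (sym (map-tabulate id (f ∘ fsuc))) ⟩
  sum (map (f ∘ fsuc) (allFin n))          ≡⟨ sum-allFin n (f ∘ fsuc) ⟩
  ∑ n (f ∘ fsuc)                           ∎)
  where open ≡-Reasoning

∑-cong : ∀ n {f g : Fin n → ℕ} → (∀ i → f i ≡ g i) → ∑ n f ≡ ∑ n g
∑-cong zero    f≗g = refl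
∑-cong (suc n) f≗g = cong₂ _+_ (f≗g fzero) (∑-cong n (f≗g ∘ fsuc))

∑-zero : ∀ n → ∑ n (λ _ → 0) ≡ 0
∑-zero zero    = refl
∑-zero (suc n) = ∑-zero n

∑-count : ∀ {n} (X : Subset n) (f : Fin n → ℕ) →
  ∑ n (λ v → if lookup X v then suc (f v) else 0) ≡ ∣ X ∣ + ∑ n (λ v → if lookup X v then f v else 0)
∑-count []          f = refl
∑-count (true ∷ X)  f = cong suc (begin
  f fzero + ∑ _ (λ v → if lookup X v then suc (f (fsuc v)) else 0) ≡⟨ cong (f fzero +_) (∑-count X (f ∘ fsuc)) ⟩
  f fzero + (∣ X ∣ + ∑ _ (λ v → if lookup X v then f (fsuc v) else 0)) ≡⟨ x∙yz≈y∙xz (f fzero) ∣ X ∣ _ ⟩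
  ∣ X ∣ + (f fzero + ∑ _ (λ v → if lookup X v then f (fsuc v) else 0)) ∎)
  where open ≡-Reasoning
∑-count (false ∷ X) f = ∑-count X (f ∘ fsuc)

vertexSum : ∀ {n} → Subset n → ℕ
vertexSum []      = 0
vertexSum (b ∷ X) = ∣ b ∷ X ∣ + vertexSum X

∑-vertex : ∀ {n} (X : Subset n) → ∑ n (λ v → if lookup X v then vertex v else 0) ≡ vertexSum X
∑-vertex []          = refl
∑-vertex (true ∷ X)  = cong suc (trans (∑-count X vertex) (cong (∣ X ∣ +_) (∑-vertex X)))
∑-vertex (false ∷ X) = trans (∑-count X vertex) (cong (∣ X ∣ +_) (∑-vertex X))

-- A new first vertex is at distance vertex v from the member v of X.
W′ : ∀ {n} → Subset n → ℕ
W′ []          = 0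
W′ (true ∷ X)  = vertexSum X + W′ X
W′ (false ∷ X) = W′ X

private
  pairTerm : ∀ {n} → Subset n → Fin n → Fin n → ℕ
  pairTerm X u v = if lookup X u ∧ lookup X v ∧ (suc (vertex u) ≤ᵇ vertex v) then dist u v else 0

  W∑ : ∀ {n} → Subset n → ℕ
  W∑ {n} X = ∑ n (λ u → ∑ n (pairTerm X u))

  W≡W∑ : ∀ {n} (X : Subset n) → W X ≡ W∑ X
  W≡W∑ {n} X = trans (cong sum (map-cong (λ u → sum-allFin n (pairTerm X u)) (allFin n)))
                     (sum-allFin n (λ u → ∑ n (pairTerm X u)))

  W∑-∷ : ∀ {n} b (X : Subset n) → W∑ (b ∷ X) ≡ (if b then vertexSum X else 0) + W∑ X
  W∑-∷ {n} b X =
    cong₂ _+_ (cong₂ _+_ (vanish b b) (firstRow b)) (∑-cong n (λ u → cong (_+ ∑ n (pairTerm X u)) (vanish (lookup X u) b)))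
    where
    vanish : ∀ c d {k} → (if c ∧ d ∧ false then k else 0) ≡ 0
    vanish c d = cong (λ e → if e then _ else 0) (trans (cong (c ∧_) (∧-zeroʳ d)) (∧-zeroʳ c))
    firstRow : ∀ b → ∑ n (λ v → pairTerm (b ∷ X) fzero (fsuc v)) ≡ (if b then vertexSum X else 0)
    firstRow true  =
      trans (∑-cong n (λ v → cong (λ e → if e then vertex v else 0) (∧-identityʳ (lookup X v)))) (∑-vertex X)
    firstRow false = ∑-zero n

  W∑≡W′ : ∀ {n} (X : Subset n) → W∑ X ≡ W′ X
  W∑≡W′ []          = refl
  W∑≡W′ (true ∷ X)  = trans (W∑-∷ true X) (cong (vertexSum X +_) (W∑≡W′ X))
  W∑≡W′ (false ∷ X) = trans (W∑-∷ false X) (W∑≡W′ X)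

W≡W′ : ∀ {n} (X : Subset n) → W X ≡ W′ X
W≡W′ X = trans (W≡W∑ X) (W∑≡W′ X)

-- Shift X Y l r: Y is X with one member moved a step right onto a non-member, and l, r count the
-- other members of X to its left and right.
data Shift : ∀ {n} → Subset n → Subset n → ℕ → ℕ → Set where
  shift    : ∀ {n} {Q : Subset n} → Shift (true ∷ false ∷ Q) (false ∷ true ∷ Q) 0 ∣ Q ∣
  skip-in  : ∀ {n} {X Y : Subset n} {l r} → Shift X Y l r → Shift (true ∷ X) (true ∷ Y) (suc l) r
  skip-out : ∀ {n} {X Y : Subset n} {l r} → Shift X Y l r → Shift (false ∷ X) (false ∷ Y) l r

shift-∣source∣ : ∀ {n} {X Y : Subset n} {l r} → Shift X Y l r → ∣ X ∣ ≡ suc (l + r)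
shift-∣source∣ shift        = refl
shift-∣source∣ (skip-in s)  = cong suc (shift-∣source∣ s)
shift-∣source∣ (skip-out s) = shift-∣source∣ s

shift-∣target∣ : ∀ {n} {X Y : Subset n} {l r} → Shift X Y l r → ∣ Y ∣ ≡ suc (l + r)
shift-∣target∣ shift        = refl
shift-∣target∣ (skip-in s)  = cong suc (shift-∣target∣ s)
shift-∣target∣ (skip-out s) = shift-∣target∣ s

shift-∣∣ : ∀ {n} {X Y : Subset n} {l r} → Shift X Y l r → ∣ Y ∣ ≡ ∣ X ∣
shift-∣∣ s = trans (shift-∣target∣ s) (sym (shift-∣source∣ s))

vertexSum-shift : ∀ {n} {X Y : Subset n} {l r} → Shift X Y l r → vertexSum Y ≡ suc (vertexSum X)
vertexSum-shift (shift {Q = Q}) = cong suc (+-suc ∣ Q ∣ (∣ Q ∣ + vertexSum Q))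
vertexSum-shift {X = true ∷ X} {true ∷ Y} (skip-in s) =
  cong suc (trans (cong₂ _+_ (shift-∣∣ s) (vertexSum-shift s)) (+-suc ∣ X ∣ (vertexSum X)))
vertexSum-shift {X = false ∷ X} {false ∷ Y} (skip-out s) =
  trans (cong₂ _+_ (shift-∣∣ s) (vertexSum-shift s)) (+-suc ∣ X ∣ (vertexSum X))

W′-shift : ∀ {n} {X Y : Subset n} {l r} → Shift X Y l r → W′ Y + r ≡ W′ X + l
W′-shift (shift {Q = Q}) = s+w+q≡q+s+w+0 (vertexSum Q) (W′ Q) ∣ Q ∣
  where
  s+w+q≡q+s+w+0 : ∀ s w q → s + w + q ≡ q + s + w + 0
  s+w+q≡q+s+w+0 = solve-∀
W′-shift {X = true ∷ X} {true ∷ Y} {suc l} {r} (skip-in s) = begin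
  vertexSum Y + W′ Y + r       ≡⟨ +-assoc (vertexSum Y) (W′ Y) r ⟩
  vertexSum Y + (W′ Y + r)     ≡⟨ cong₂ _+_ (vertexSum-shift s) (W′-shift s) ⟩
  suc (vertexSum X) + (W′ X + l) ≡⟨ 1+s+[w+l]≡s+w+[1+l] (vertexSum X) (W′ X) l ⟩
  vertexSum X + W′ X + suc l   ∎
  where
  open ≡-Reasoning
  1+s+[w+l]≡s+w+[1+l] : ∀ s w l → suc s + (w + l) ≡ s + w + suc l
  1+s+[w+l]≡s+w+[1+l] = solve-∀
W′-shift (skip-out s) = W′-shift s

p─⊥∪⊥≡p : ∀ {n} (Q : Subset n) → (Q ─ ⊥) ∪ ⊥ ≡ Q
p─⊥∪⊥≡p Q = trans (∪-identityʳ (Q ─ ⊥)) (p─⊥≡p Q)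

shift-right : ∀ {n} (A : Subset n) {u v} → lookup A u ≡ true → lookup A v ≡ false →
  vertex v ≡ suc (vertex u) → ∃₂ (Shift A ((A - u) ∪ ⁅ v ⁆))
shift-right (true ∷ false ∷ Q) {fzero} {fsuc fzero} refl refl refl =
  0 , ∣ Q ∣ , subst (λ Z → Shift (true ∷ false ∷ Q) (false ∷ true ∷ Z) 0 ∣ Q ∣) (sym (p─⊥∪⊥≡p Q)) shift
shift-right (true ∷ A)  {fsuc u} {fsuc v} u∈A v∉A v≡u+1 =
  Product.map suc (Product.map₂ skip-in) (shift-right A u∈A v∉A (suc-injective v≡u+1))
shift-right (false ∷ A) {fsuc u} {fsuc v} u∈A v∉A v≡u+1 =
  Product.map₂ (Product.map₂ skip-out) (shift-right A u∈A v∉A (suc-injective v≡u+1))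
shift-right _ {fzero} {fzero}  _ _ ()
shift-right _ {fzero} {fsuc (fsuc _)} _ _ ()
shift-right _ {fsuc _} {fzero} _ _ ()

shift-left : ∀ {n} (A : Subset n) {u v} → lookup A u ≡ true → lookup A v ≡ false →
  vertex u ≡ suc (vertex v) → ∃₂ (Shift ((A - u) ∪ ⁅ v ⁆) A)
shift-left (false ∷ true ∷ Q) {fsuc fzero} {fzero} refl refl refl =
  0 , ∣ Q ∣ , subst (λ Z → Shift (true ∷ false ∷ Z) (false ∷ true ∷ Q) 0 ∣ Q ∣) (sym (p─⊥∪⊥≡p Q)) shift
shift-left (true ∷ A)  {fsuc u} {fsuc v} u∈A v∉A u≡v+1 =
  Product.map suc (Product.map₂ skip-in) (shift-left A u∈A v∉A (suc-injective u≡v+1))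
shift-left (false ∷ A) {fsuc u} {fsuc v} u∈A v∉A u≡v+1 =
  Product.map₂ (Product.map₂ skip-out) (shift-left A u∈A v∉A (suc-injective u≡v+1))
shift-left _ {fzero} _ _ ()
shift-left _ {fsuc (fsuc _)} {fzero} _ _ ()

∉⇒lookup≡false : ∀ {n} {A : Subset n} {v} → v ∉ A → lookup A v ≡ false
∉⇒lookup≡false {A = A} {v} v∉A = ¬-not (v∉A ∘ lookup⇒[]= v A)

perturbation⇒shift : ∀ {n} {A B : Subset n} → Perturbation A B → ∃₂ (Shift A B) ⊎ ∃₂ (Shift B A)
perturbation⇒shift {A = A} (u , v , u∈A , v∉A , inj₁ v≡u+1 , refl) =
  inj₁ (shift-right A ([]=⇒lookup u∈A) (∉⇒lookup≡false v∉A) v≡u+1)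
perturbation⇒shift {A = A} (u , v , u∈A , v∉A , inj₂ u≡v+1 , refl) =
  inj₂ (shift-left A ([]=⇒lookup u∈A) (∉⇒lookup≡false v∉A) u≡v+1)

perturbation-∣∣ : ∀ {n} {A B : Subset n} → Perturbation A B → ∣ B ∣ ≡ ∣ A ∣
perturbation-∣∣ p with perturbation⇒shift p
... | inj₁ (_ , _ , s) = shift-∣∣ s
... | inj₂ (_ , _ , s) = sym (shift-∣∣ s)

perturbation-∷ : ∀ {n} c {X Y : Subset n} → Perturbation X Y → Perturbation (c ∷ X) (c ∷ Y)
perturbation-∷ c (u , v , u∈X , v∉X , edge , refl) =
  fsuc u , fsuc v , there u∈X , (λ { (there v∈X) → v∉X v∈X }) , Sum.map (cong suc) (cong suc) edge ,
  cong (_∷ _) (sym (∨-identityʳ c))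

shift⇒perturbations : ∀ {n} {X Y : Subset n} {l r} → Shift X Y l r → Perturbation X Y × Perturbation Y X
shift⇒perturbations (shift {Q = Q}) =
    (fzero , fsuc fzero , here , (λ { (there ()) }) , inj₁ refl , cong (λ Z → false ∷ true ∷ Z) (sym (p─⊥∪⊥≡p Q)))
  , (fsuc fzero , fzero , there here , (λ ()) , inj₂ refl , cong (λ Z → true ∷ false ∷ Z) (sym (p─⊥∪⊥≡p Q)))
shift⇒perturbations (skip-in s)  = Product.map (perturbation-∷ true)  (perturbation-∷ true)  (shift⇒perturbations s)
shift⇒perturbations (skip-out s) = Product.map (perturbation-∷ false) (perturbation-∷ false) (shift⇒perturbations s)

-- X is the final segment of a set with a further members on its left, and no shift inside X
-- increases W of that set.
record Balanced {n} (a : ℕ) (X : Subset n) : Set where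
  field
    right-shift : ∀ {Y l r} → Shift X Y l r → a + l ≤ r
    left-shift  : ∀ {Y l r} → Shift Y X l r → r ≤ a + l
open Balanced

localMaximizer⇒balanced : ∀ {n} {A : Subset n} → LocalMaximizer A → Balanced 0 A
localMaximizer⇒balanced {A = A} local = record
  { right-shift = λ {Y} {l} {r} s → +-cancelˡ-≤ (W′ A) l r (begin
      W′ A + l ≡⟨ sym (W′-shift s) ⟩
      W′ Y + r ≤⟨ +-monoˡ-≤ r (W′-decreases (Product.proj₁ (shift⇒perturbations s))) ⟩
      W′ A + r ∎)
  ; left-shift = λ {Y} {l} {r} s → +-cancelˡ-≤ (W′ A) r l (begin
      W′ A + r ≡⟨ W′-shift s ⟩
      W′ Y + l ≤⟨ +-monoˡ-≤ l (W′-decreases (Product.proj₂ (shift⇒perturbations s))) ⟩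
      W′ A + l ∎)
  }
  where
  open ≤-Reasoning
  W′-decreases : ∀ {B} → Perturbation A B → W′ B ≤ W′ A
  W′-decreases {B} p = subst₂ _≤_ (W≡W′ B) (W≡W′ A) (local B p)

balanced-true∷ : ∀ {n a} {X : Subset n} → Balanced a (true ∷ X) → Balanced (suc a) X
balanced-true∷ {a = a} bal = record
  { right-shift = λ {_} {l} {r} s → subst (_≤ r) (+-suc a l) (right-shift bal (skip-in s))
  ; left-shift  = λ {_} {l} {r} s → subst (r ≤_) (+-suc a l) (left-shift bal (skip-in s))
  }

balanced-false∷ : ∀ {n a} {X : Subset n} → Balanced a (false ∷ X) → Balanced a X
balanced-false∷ bal = record
  { right-shift = right-shift bal ∘ skip-out
  ; left-shift  = left-shift bal ∘ skip-out
  }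

lastBlock : (n e : ℕ) → Subset n
lastBlock n e = interval n (n ∸ e + 1) n

-- There is no vertex 0, so blocks n d 0 e consists of the two end blocks only.
blocks : (n d j e : ℕ) → Subset n
blocks n d j e = (interval n 1 d ∪ interval n j j) ∪ lastBlock n e

interval-empty : ∀ n → interval n 1 0 ≡ ⊥
interval-empty zero    = refl
interval-empty (suc n) = cong (false ∷_) (interval-empty n)

interval-full : ∀ n → interval n 1 n ≡ ⊤
interval-full zero    = refl
interval-full (suc n) = cong (true ∷_) (interval-full n)

lastBlock-suc : ∀ {n e} → e ≤ n → lastBlock (suc n) e ≡ false ∷ lastBlock n e
lastBlock-suc {n} {e} e≤n = begin
  interval (suc n) (suc n ∸ e + 1) (suc n)     ≡⟨ cong (λ a → interval (suc n) a (suc n)) start ⟩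
  interval (suc n) (suc (suc (n ∸ e))) (suc n) ≡⟨⟩
  false ∷ interval n (suc (n ∸ e)) n           ≡⟨ cong (λ a → false ∷ interval n a n) (+-comm 1 (n ∸ e)) ⟩
  false ∷ interval n (n ∸ e + 1) n             ∎
  where
  open ≡-Reasoning
  start : suc n ∸ e + 1 ≡ suc (suc (n ∸ e))
  start = trans (+-comm (suc n ∸ e) 1) (cong suc (+-∸-assoc 1 e≤n))

lastBlock-full : ∀ n → lastBlock n n ≡ ⊤
lastBlock-full n = trans (cong (λ a → interval n (a + 1) n) (n∸n≡0 n)) (interval-full n)

blocks-suc : ∀ {n} d j e → e ≤ n →
  blocks (suc n) d j e ≡ ((0 <ᵇ d) ∨ (j ≡ᵇ 1)) ∷ blocks n (pred d) (pred j) e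
blocks-suc {n} d j e e≤n =
  trans (cong ((interval (suc n) 1 d ∪ interval (suc n) j j) ∪_) (lastBlock-suc e≤n)) (split-first d j)
  where
  split-first : ∀ d j → (interval (suc n) 1 d ∪ interval (suc n) j j) ∪ (false ∷ lastBlock n e)
                        ≡ ((0 <ᵇ d) ∨ (j ≡ᵇ 1)) ∷ blocks n (pred d) (pred j) e
  split-first zero    zero          = refl
  split-first zero    (suc zero)    = refl
  split-first zero    (suc (suc j)) = refl
  split-first (suc d) zero          = refl
  split-first (suc d) (suc zero)    = refl
  split-first (suc d) (suc (suc j)) = refl

blocks-no-point : ∀ n d e → blocks n d 0 e ≡ interval n 1 d ∪ lastBlock n e
blocks-no-point n d e =
  cong (_∪ lastBlock n e) (trans (cong (interval n 1 d ∪_) (interval-empty n)) (∪-identityʳ _))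

blocks-0-0 : ∀ n e → blocks n 0 0 e ≡ lastBlock n e
blocks-0-0 n e =
  trans (blocks-no-point n 0 e) (trans (cong (_∪ lastBlock n e) (interval-empty n)) (∪-identityˡ _))

balanced-gap : ∀ {n a} {X : Subset n} → Balanced a (false ∷ X) → ∣ X ∣ ≤ suc a
balanced-gap {X = []}              bal = z≤n
balanced-gap {a = a} {X = true ∷ Q} bal = s≤s (subst (∣ Q ∣ ≤_) (+-identityʳ a) (left-shift bal shift))
balanced-gap {X = false ∷ X}       bal = balanced-gap (balanced-false∷ bal)

balanced-full : ∀ {n a} {X : Subset n} → Balanced a (true ∷ X) → ∣ X ∣ < a → X ≡ ⊤
balanced-full {X = []}               bal size = refl
balanced-full {X = true ∷ X}         bal size =
  cong (true ∷_) (balanced-full (balanced-true∷ bal) (m≤n⇒m≤1+n (<⇒≤ size)))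
balanced-full {a = a} {X = false ∷ Q} bal size =
  ⊥-elim (<⇒≱ size (subst (_≤ ∣ Q ∣) (+-identityʳ a) (right-shift bal shift)))

balanced-lastBlock : ∀ {n a} {X : Subset n} → Balanced a X → ∣ X ∣ ≤ a → X ≡ lastBlock n ∣ X ∣
balanced-lastBlock {X = []} bal size = refl
balanced-lastBlock {suc n} {X = true ∷ X} bal size = begin
  true ∷ X                  ≡⟨ cong (true ∷_) X≡⊤ ⟩
  ⊤                         ≡⟨ sym (lastBlock-full (suc n)) ⟩
  lastBlock (suc n) (suc n) ≡⟨ cong (lastBlock (suc n) ∘ suc) (sym (trans (cong ∣_∣ X≡⊤) (∣⊤∣≡n n))) ⟩
  lastBlock (suc n) (suc ∣ X ∣) ∎
  where
  open ≡-Reasoning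
  X≡⊤ = balanced-full bal size
balanced-lastBlock {suc n} {X = false ∷ X} bal size =
  trans (cong (false ∷_) (balanced-lastBlock (balanced-false∷ bal) size)) (sym (lastBlock-suc (∣p∣≤n X)))

balanced-point : ∀ {n a} {X : Subset n} → Balanced a X → ∣ X ∣ ≡ suc a →
  ∃ λ j → 0 < j × j + a ≤ n × X ≡ blocks n 0 j a
balanced-point {X = []} bal ()
balanced-point {suc n} {a} {X = true ∷ X} bal size =
  1 , s≤s z≤n , s≤s a≤n , trans (cong (true ∷_) X≡blocks) (sym (blocks-suc 0 1 a a≤n))
  where
  ∣X∣≡a = suc-injective size
  a≤n = subst (_≤ n) ∣X∣≡a (∣p∣≤n X)
  X≡blocks : X ≡ blocks n 0 0 a
  X≡blocks = trans (balanced-lastBlock (balanced-true∷ bal) (m≤n⇒m≤1+n (≤-reflexive ∣X∣≡a)))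
                   (trans (cong (lastBlock n) ∣X∣≡a) (sym (blocks-0-0 n a)))
balanced-point {suc n} {a} {X = false ∷ X} bal size with balanced-point (balanced-false∷ bal) size
... | suc j , _ , j+a≤n , X≡blocks =
  suc (suc j) , s≤s z≤n , s≤s j+a≤n ,
  trans (cong (false ∷_) X≡blocks) (sym (blocks-suc 0 (suc (suc j)) a (≤-trans (m≤n+m a (suc j)) j+a≤n)))

private
  peeled-size : ∀ d a {m} → suc m ≡ suc d + (suc d + a) → m ≡ d + (d + suc a)
  peeled-size d a size = trans (suc-injective size) (cong (d +_) (sym (+-suc d a)))

  peeled-bound : ∀ {n} d a {X : Subset n} → ∣ X ∣ ≡ d + (d + suc a) → suc d + a ≤ n
  peeled-bound {n} d a {X} size =
    ≤-trans (subst (_≤ d + (d + suc a)) (+-suc d a) (m≤n+m (d + suc a) d)) (subst (_≤ n) size (∣p∣≤n X))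

  1+a<[1+d]+[1+d+a] : ∀ d a → suc a < suc d + (suc d + a)
  1+a<[1+d]+[1+d+a] d a = s≤s (≤-trans (s≤s (m≤n+m a d)) (m≤n+m (suc (d + a)) d))

balanced-even : ∀ {n a} d {X : Subset n} → Balanced a X → ∣ X ∣ ≡ d + (d + a) → X ≡ blocks n d 0 (d + a)
balanced-even {n} {a} zero {X} bal size =
  trans (balanced-lastBlock bal (≤-reflexive size)) (trans (cong (lastBlock n) size) (sym (blocks-0-0 n a)))
balanced-even (suc d) {[]} bal ()
balanced-even {a = a} (suc d) {false ∷ X} bal size =
  ⊥-elim (<⇒≱ (subst (suc a <_) (sym size) (1+a<[1+d]+[1+d+a] d a)) (balanced-gap bal))
balanced-even {suc n} {a} (suc d) {true ∷ X} bal size = begin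
  true ∷ X                           ≡⟨ cong (true ∷_) (balanced-even d (balanced-true∷ bal) X-size) ⟩
  true ∷ blocks n d 0 (d + suc a)    ≡⟨ cong (λ e → true ∷ blocks n d 0 e) (+-suc d a) ⟩
  true ∷ blocks n d 0 (suc d + a)    ≡⟨ sym (blocks-suc (suc d) 0 (suc d + a) (peeled-bound d a {X} X-size)) ⟩
  blocks (suc n) (suc d) 0 (suc d + a) ∎
  where
  open ≡-Reasoning
  X-size = peeled-size d a size

balanced-odd : ∀ {n a} d {X : Subset n} → Balanced a X → ∣ X ∣ ≡ d + (d + suc a) →
  ∃ λ j → d < j × j + (d + a) ≤ n × X ≡ blocks n d j (d + a)
balanced-odd zero bal size = balanced-point bal size
balanced-odd (suc d) {[]} bal ()
balanced-odd {a = a} (suc d) {false ∷ X} bal size =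
  ⊥-elim (<⇒≱ (subst (suc a <_) (sym size) (<⇒≤ (1+a<[1+d]+[1+d+a] d (suc a)))) (balanced-gap bal))
balanced-odd {suc n} {a} (suc d) {true ∷ X} bal size
  with balanced-odd d (balanced-true∷ bal) (peeled-size d (suc a) size)
... | j , d<j , j+e≤n , X≡blocks =
  suc j , s≤s d<j , s≤s (subst (λ e → j + e ≤ n) (+-suc d a) j+e≤n) , (begin
    true ∷ X                        ≡⟨ cong (true ∷_) X≡blocks ⟩
    true ∷ blocks n d j (d + suc a) ≡⟨ cong (λ e → true ∷ blocks n d j e) (+-suc d a) ⟩
    true ∷ blocks n d j (suc d + a) ≡⟨ sym (blocks-suc (suc d) (suc j) (suc d + a) e≤n) ⟩
    blocks (suc n) (suc d) (suc j) (suc d + a) ∎)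
  where
  open ≡-Reasoning
  e≤n = ≤-trans (+-monoʳ-≤ (suc d) (n≤1+n a)) (peeled-bound d (suc a) {X} (peeled-size d (suc a) size))

blocks-shift : ∀ {n} d j e → d < j → suc j + e ≤ n →
  ∃ λ r → Shift (blocks n d j e) (blocks n d (suc j) e) d r
blocks-shift {suc (suc n)} zero (suc zero) e _ (s≤s (s≤s e≤n)) =
  ∣ blocks n 0 0 e ∣ ,
  subst₂ (λ X Y → Shift X Y 0 ∣ blocks n 0 0 e ∣)
    (sym (trans (blocks-suc 0 1 e (m≤n⇒m≤1+n e≤n)) (cong (true ∷_) (blocks-suc 0 0 e e≤n))))
    (sym (trans (blocks-suc 0 2 e (m≤n⇒m≤1+n e≤n)) (cong (false ∷_) (blocks-suc 0 1 e e≤n))))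
    shift
blocks-shift {suc n} zero (suc (suc j)) e _ (s≤s le) with blocks-shift 0 (suc j) e (s≤s z≤n) le
... | r , s = r , subst₂ (λ X Y → Shift X Y 0 r)
                    (sym (blocks-suc 0 (2 + j) e e≤n)) (sym (blocks-suc 0 (3 + j) e e≤n)) (skip-out s)
  where e≤n = ≤-trans (m≤n+m e (2 + j)) le
blocks-shift {suc n} (suc d) (suc j) e (s≤s d<j) (s≤s le) with blocks-shift d j e d<j le
... | r , s = r , subst₂ (λ X Y → Shift X Y (suc d) r)
                    (sym (blocks-suc (suc d) (suc j) e e≤n)) (sym (blocks-suc (suc d) (2 + j) e e≤n)) (skip-in s)
  where e≤n = ≤-trans (m≤n+m e (suc j)) le

-- Each step moves the median with d members on its left, and the size forces d on its right too.
W′-blocks-median : ∀ {n} d j e → d < j → j + e ≤ n → ∣ blocks n d j e ∣ ≡ suc (d + d) →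
  W′ (blocks n d j e) ≡ W′ (blocks n d (suc d) e)
W′-blocks-median {n} d (suc j) e d<1+j le size with m≤n⇒m<n∨m≡n (s≤s⁻¹ d<1+j)
... | inj₂ refl = refl
... | inj₁ d<j with blocks-shift d j e d<j le
...   | r , s = trans W′-step (W′-blocks-median d j e d<j (<⇒≤ le) (trans (sym (shift-∣∣ s)) size))
  where
  r≡d : r ≡ d
  r≡d = +-cancelˡ-≡ d r d (suc-injective (trans (sym (shift-∣target∣ s)) size))
  W′-step : W′ (blocks n d (suc j) e) ≡ W′ (blocks n d j e)
  W′-step = +-cancelʳ-≡ d _ _ (trans (cong (W′ (blocks n d (suc j) e) +_) (sym r≡d)) (W′-shift s))

argmax : ∀ n (f : Subset n → ℕ) → ∃ λ M → ∀ X → f X ≤ f M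
argmax zero    f = [] , λ { [] → ≤-refl }
argmax (suc n) f with argmax n (f ∘ (true ∷_)) | argmax n (f ∘ (false ∷_))
... | M₁ , max₁ | M₀ , max₀ with f (true ∷ M₁) ≤? f (false ∷ M₀)
...   | yes ≤₀ = false ∷ M₀ , λ { (true ∷ X) → ≤-trans (max₁ X) ≤₀ ; (false ∷ X) → max₀ X }
...   | no  ≰₀ = true ∷ M₁  , λ { (true ∷ X) → max₁ X ; (false ∷ X) → ≤-trans (max₀ X) (≰⇒≥ ≰₀) }

maximizer-exists : ∀ {n} (A : Subset n) → ∃ λ M → ∣ M ∣ ≡ ∣ A ∣ × Maximizer M
maximizer-exists {n} A =
  M , M-size ,
  λ B B-size → s≤s⁻¹ (subst₂ _≤_ (score-W B (trans B-size M-size)) (score-W M M-size) (M-max B))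
  where
  -- The suc lifts every set of size ∣ A ∣ above all other sets.
  score : Subset n → ℕ
  score X with ∣ X ∣ ≟ ∣ A ∣
  ... | yes _ = suc (W X)
  ... | no  _ = 0
  score-W : ∀ X → ∣ X ∣ ≡ ∣ A ∣ → score X ≡ suc (W X)
  score-W X size with ∣ X ∣ ≟ ∣ A ∣
  ... | yes _   = refl
  ... | no  ≢∣A∣ = contradiction size ≢∣A∣
  score-size : ∀ X → 0 < score X → ∣ X ∣ ≡ ∣ A ∣
  score-size X pos with ∣ X ∣ ≟ ∣ A ∣ | pos
  ... | yes size | _ = size
  ... | no  _    | ()
  M = Product.proj₁ (argmax n score)
  M-max = Product.proj₂ (argmax n score)
  M-size : ∣ M ∣ ≡ ∣ A ∣
  M-size = score-size M (≤-trans (s≤s z≤n) (subst (_≤ score M) (score-W A refl) (M-max A)))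

maximizer⇒localMaximizer : ∀ {n} {A : Subset n} → Maximizer A → LocalMaximizer A
maximizer⇒localMaximizer max B p = max B (perturbation-∣∣ p)

CanonicalForm : (n : ℕ) → Subset n → ℕ → Set
CanonicalForm n A m =
    (m % 2 ≡ 0 → A ≡ interval n 1 (m / 2) ∪ lastBlock n (m / 2))
  × (m % 2 ≡ 1 → ∃[ j ] ((m ∸ 1) / 2 < j × j < n ∸ (m ∸ 1) / 2 + 1
                          × A ≡ blocks n ((m ∸ 1) / 2) j ((m ∸ 1) / 2)))

parity : ∀ m → m % 2 ≡ 0 ⊎ m % 2 ≡ 1
parity m with m % 2 | m%n<n m 2
... | 0           | _              = inj₁ refl
... | 1           | _              = inj₂ refl
... | suc (suc _) | s≤s (s≤s ())

even-half : ∀ m → m % 2 ≡ 0 → m ≡ m / 2 + (m / 2 + 0)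
even-half m even = trans (m≡m%n+[m/n]*n m 2) (trans (cong (_+ m / 2 * 2) even) (*-comm (m / 2) 2))

odd-half : ∀ m → m % 2 ≡ 1 → m ≡ suc ((m ∸ 1) / 2 + (m ∸ 1) / 2)
odd-half m odd = begin
  m                 ≡⟨ m≡1+q*2 ⟩
  suc (q * 2)       ≡⟨ cong suc (trans (*-comm q 2) (cong (q +_) (+-identityʳ q))) ⟩
  suc (q + q)       ≡⟨ cong (λ k → suc (k + k)) (sym k≡q) ⟩
  suc (k + k)       ∎
  where
  open ≡-Reasoning
  q = m / 2
  k = (m ∸ 1) / 2
  m≡1+q*2 : m ≡ suc (q * 2)
  m≡1+q*2 = trans (m≡m%n+[m/n]*n m 2) (cong (_+ q * 2) odd)
  k≡q : k ≡ q
  k≡q = trans (cong (λ x → (x ∸ 1) / 2) m≡1+q*2) (m*n/n≡m q 2)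

+≤⇒<∸+1 : ∀ {j k n} → j + k ≤ n → j < n ∸ k + 1
+≤⇒<∸+1 {j} {k} {n} j+k≤n = subst (j <_) (+-comm 1 (n ∸ k)) (s≤s (m+n≤o⇒m≤o∸n j j+k≤n))

<∸+1⇒+≤ : ∀ {j k n} → 0 < j → j < n ∸ k + 1 → j + k ≤ n
<∸+1⇒+≤ {j} {k} {n} 0<j j<n∸k+1 = m≤o∸n⇒m+n≤o j k≤n j≤n∸k
  where
  j≤n∸k = s≤s⁻¹ (subst (j <_) (+-comm (n ∸ k) 1) j<n∸k+1)
  k≤n = <⇒≤ (m∸n≢0⇒n<m (λ n∸k≡0 → <⇒≱ 0<j (subst (j ≤_) n∸k≡0 j≤n∸k)))

localMaximizer⇒canonical : ∀ {n} {A : Subset n} {m} → ∣ A ∣ ≡ m → LocalMaximizer A → CanonicalForm n A m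
localMaximizer⇒canonical {n} {A} {m} size local = even , odd
  where
  bal = localMaximizer⇒balanced local
  h = m / 2
  k = (m ∸ 1) / 2
  even : m % 2 ≡ 0 → A ≡ interval n 1 h ∪ lastBlock n h
  even m-even = trans (balanced-even h bal (trans size (even-half m m-even)))
                      (trans (cong (blocks n h 0) (+-identityʳ h)) (blocks-no-point n h h))
  1+[k+k]≡k+[k+1] : suc (k + k) ≡ k + (k + 1)
  1+[k+k]≡k+[k+1] = trans (sym (+-suc k k)) (cong (k +_) (+-comm 1 k))
  odd : m % 2 ≡ 1 → ∃[ j ] (k < j × j < n ∸ k + 1 × A ≡ blocks n k j k)
  odd m-odd with balanced-odd k bal (trans size (trans (odd-half m m-odd) 1+[k+k]≡k+[k+1]))
  ... | j , k<j , j+k≤n , A≡blocks =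
    j , k<j , +≤⇒<∸+1 (subst (λ e → j + e ≤ n) (+-identityʳ k) j+k≤n) ,
    trans A≡blocks (cong (blocks n k j) (+-identityʳ k))

canonical⇒maximizer : ∀ {n} {A : Subset n} {m} → ∣ A ∣ ≡ m → CanonicalForm n A m → Maximizer A
canonical⇒maximizer {n} {A} {m} size (A-even , A-odd) with maximizer-exists A
... | M , M-size , M-max
  with localMaximizer⇒canonical {A = M} (trans M-size size) (maximizer⇒localMaximizer {A = M} M-max) | parity m
...   | M-even , _     | inj₁ m-even = subst (Maximizer {n}) (trans (M-even m-even) (sym (A-even m-even))) M-max
...   | _      , M-odd | inj₂ m-odd   = λ B B-size → subst (W B ≤_) W-M≡W-A (M-max B (trans B-size (sym M-size)))
  where
  k = (m ∸ 1) / 2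
  W′-canonical : ∀ X → ∣ X ∣ ≡ m → ∃[ j ] (k < j × j < n ∸ k + 1 × X ≡ blocks n k j k) →
    W′ X ≡ W′ (blocks n k (suc k) k)
  W′-canonical X X-size (j , k<j , j<n∸k+1 , refl) =
    W′-blocks-median k j k k<j (<∸+1⇒+≤ (≤-trans (s≤s z≤n) k<j) j<n∸k+1) (trans X-size (odd-half m m-odd))
  W-M≡W-A : W M ≡ W A
  W-M≡W-A = begin
    W M                          ≡⟨ W≡W′ M ⟩
    W′ M                         ≡⟨ W′-canonical M (trans M-size size) (M-odd m-odd) ⟩
    W′ (blocks n k (suc k) k)    ≡⟨ sym (W′-canonical A size (A-odd m-odd)) ⟩
    W′ A                         ≡⟨ sym (W≡W′ A) ⟩
    W A                          ∎
    where open ≡-Reasoning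

proposition4p2 : (n : ℕ) (A : Subset n) (m : ℕ) → ∣ A ∣ ≡ m → 2 ≤ m → m ≤ n →
    (Maximizer A ⇔ LocalMaximizer A)
    × (LocalMaximizer A ⇔
        ((m % 2 ≡ 0 → A ≡ interval n 1 (m / 2) ∪ interval n (n ∸ m / 2 + 1) n)
        × (m % 2 ≡ 1 → ∃[ j ] ((m ∸ 1) / 2 < j × j < n ∸ (m ∸ 1) / 2 + 1
             × A ≡ (interval n 1 ((m ∸ 1) / 2) ∪ interval n j j) ∪ interval n (n ∸ (m ∸ 1) / 2 + 1) n))))
proposition4p2 n A m size _ _ =
    mk⇔ maximizer⇒localMaximizer (canonical⇒maximizer size ∘ localMaximizer⇒canonical size)
  , mk⇔ (localMaximizer⇒canonical size) (maximizer⇒localMaximizer ∘ canonical⇒maximizer size)
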